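{- (i) For every tree $T$, the number of dependent sets of even size of $T$ differs by at most one from the number of dependent sets of odd size. (ii) If $T$ is a well-covered tree not isomorphic to $K_2$, then the number of dependent sets of even size of $T$ equals the number of dependent sets of odd size. (iii) If $T$ is a well-covered tree not isomorphic to $K_2$, then the number of all stable sets of $T$ and the number of all dependent sets of $T$ are both even.
   Context: A tree is a connected acyclic finite graph. A stable set is a subset of vertices that are pairwise non-adjacent (the empty set is a stable set of size $0$); a dependent set is a subset of the vertex set that is not stable. A graph is well-covered if all its maximal (by inclusion) stable sets have the same size. $K_2$ is the graph consisting of a single edge. -}

module Defs where

open import Data.Nat using (ℕ; zero; suc; _≤_; ∣_-_∣)
open import Data.Nat.Divisibility using (_∣_; _∣?_)
open import Data.Fin using (Fin)
open import Data.Fin.Properties using (all?)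
open import Data.Fin.Subset using (Subset; _∈_; _∉_; _⊆_; ∣_∣; ⁅_⁆; _∪_)
open import Data.Fin.Subset.Properties using (_∈?_)
open import Data.Bool using (true; false)
open import Data.Vec using ([]; _∷_)
open import Data.List using (List; []; _∷_; [_]; map; _++_; length; filter; _∷ʳ_)
open import Data.List.Relation.Unary.Unique.Propositional using (Unique)
open import Data.List.Relation.Unary.Linked using (Linked)
open import Data.Product using (Σ; ∃; _×_; _,_)
open import Relation.Nullary using (¬_; Dec; yes; no)
open import Relation.Nullary.Decidable using (_×-dec_; ¬?; _→-dec_)
open import Relation.Binary using (Decidable; Symmetric; Irreflexive)
open import Relation.Binary.PropositionalEquality using (_≡_; _≢_)
open import Function.Bundles using (_↔_; Inverse; _⇔_)

record Graph (n : ℕ) : Set₁ where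
  field
    Adj    : Fin n → Fin n → Set
    adj?   : Decidable Adj
    sym    : Symmetric Adj
    irrefl : Irreflexive _≡_ Adj
open Graph public

module _ {n : ℕ} (G : Graph n) where

  data Walk : Fin n → Fin n → Set where
    here : ∀ {u} → Walk u u
    step : ∀ {u v w} → Adj G u v → Walk v w → Walk u w

  Connected : Set
  Connected = ∀ u v → Walk u v

  HasCycle : Set
  HasCycle = Σ (Fin n) λ u → Σ (List (Fin n)) λ vs →
    (2 ≤ length vs) × Unique (u ∷ vs) × Linked (Adj G) ((u ∷ vs) ∷ʳ u)

  Acyclic : Set
  Acyclic = ¬ HasCycle

  Stable : Subset n → Set
  Stable S = ∀ u v → u ∈ S → v ∈ S → ¬ Adj G u v

  Dependent : Subset n → Set
  Dependent S = ¬ Stable S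

  stable? : (S : Subset n) → Dec (Stable S)
  stable? S = all? λ u → all? λ v →
    (u ∈? S) →-dec ((v ∈? S) →-dec ¬? (adj? G u v))

  dependent? : (S : Subset n) → Dec (Dependent S)
  dependent? S = ¬? (stable? S)

  MaximalStable : Subset n → Set
  MaximalStable S = Stable S × (∀ T → S ⊆ T → Stable T → T ≡ S)

  WellCovered : Set
  WellCovered = ∀ S T → MaximalStable S → MaximalStable T → ∣ S ∣ ≡ ∣ T ∣

Tree : ∀ {n} → Graph n → Set
Tree {n} G = 1 ≤ n × Connected G × Acyclic G

allSubsets : ∀ n → List (Subset n)
allSubsets zero    = [ [] ]
allSubsets (suc n) = map (true ∷_) (allSubsets n) ++ map (false ∷_) (allSubsets n)

Even : ℕ → Set
Even k = 2 ∣ k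

Odd : ℕ → Set
Odd k = ¬ Even k

even? : (k : ℕ) → Dec (Even k)
even? k = 2 ∣? k

#stable : ∀ {n} → Graph n → ℕ
#stable {n} G = length (filter (stable? G) (allSubsets n))

#dependent : ∀ {n} → Graph n → ℕ
#dependent {n} G = length (filter (dependent? G) (allSubsets n))

#dependentEven : ∀ {n} → Graph n → ℕ
#dependentEven {n} G =
  length (filter (λ S → dependent? G S ×-dec even? ∣ S ∣) (allSubsets n))

#dependentOdd : ∀ {n} → Graph n → ℕ
#dependentOdd {n} G =
  length (filter (λ S → dependent? G S ×-dec ¬? (even? ∣ S ∣)) (allSubsets n))

K₂ : Graph 2
K₂ = record
  { Adj = λ u v → u ≢ v
  ; adj? = λ u v → ¬? (u Data.Fin.≟ v)
  ; sym = λ u≢v v≡u → u≢v (Relation.Binary.PropositionalEquality.sym v≡u)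
  ; irrefl = λ u≡v u≢v → u≢v u≡v
  }

_≅_ : ∀ {n m} → Graph n → Graph m → Set
_≅_ {n} {m} G H = Σ (Fin n ↔ Fin m) λ f →
  ∀ u v → Adj G u v ⇔ Adj H (Inverse.to f u) (Inverse.to f v)

module Submission where

-- Let I(W) = Σ (−1)^|S| over the stable sets S of the induced subgraph G[W] (alternatingCount).
-- Splitting on a vertex v ∈ W gives I(W) = I(W − v) − I(W − N[v]).  Hence I(W) = 0 if G[W] has an
-- isolated vertex, and I(W) = −I(W − N[v]) if v is the neighbour of a leaf; as every nonempty forest
-- has one or the other, |I| ≤ 1 on forests.  Since the subsets of a nonempty set have signed count 0,
-- #dependentEven − #dependentOdd = −I(V), which is (i).
-- If moreover G[W] is well-covered and I(W) ≠ 0, then G[W] is a perfect matching: by induction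
-- G[W − N[v]] is one, and a second neighbour w of v would give maximal stable sets B + v and B + u + w
-- of different sizes (u the leaf, B one vertex from each edge of G[W − N[v]], avoiding N(w)).
-- A connected perfect matching is K₂, so I(V) = 0 for a well-covered tree T ≇ K₂: both the dependent
-- and the stable sets of T split evenly by parity of size, giving (ii) and (iii).

-- A separate scope: with ℤ's _-_ in scope, ℕ's ∣ m - n ∣ in the statement of corollary2p5 would not
-- parse.
module AlternatingCount where

  open import Defs renaming (sym to Adj-sym; irrefl to Adj-irrefl)
  open import Data.Bool using (true; false; if_then_else_)
  open import Data.Empty using (⊥-elim)
  open import Data.Fin as Fin using (Fin; zero; suc; _≟_)
  open import Data.Fin.Properties as Finₚ using (pigeonhole; any?; all?; ¬∀⟶∃¬)
  open import Data.Fin.Subset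
    using (Subset; inside; outside; _∈_; _∉_; _⊆_; _⊂_; _─_; _∪_; ⁅_⁆; ∣_∣; ⊥; ⊤; Nonempty; Empty)
  open import Data.Fin.Subset.Induction using (⊂-wellFounded; Acc; acc)
  open import Data.Fin.Subset.Properties
    using ( _∈?_; _⊆?_; nonempty?; ∉⊥; ⊥⊆; ∣⊥∣≡0; Empty-unique; ∈⊤; ⊆⊤; ⊆-antisym; p⊆q⇒∣p∣≤∣q∣
          ; x∈⁅x⁆; x∈⁅y⁆⇒x≡y; x∈p∪q⁻; p⊆p∪q; q⊆p∪q; ∪-identityˡ; x∈p∩q⁺
          ; p─q⊆p; x∈p∧x∉q⇒x∈p─q; x∈p∧x≢y⇒x∈p-y; p∩q≢∅⇒p─q⊂p )
  open import Data.Integer as ℤ using (ℤ; +_; -_; _+_; _-_; _⊖_; 0ℤ; 1ℤ; -1ℤ)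
  import Data.Integer.Properties as ℤₚ
  open import Algebra.Properties.CommutativeSemigroup ℤₚ.+-commutativeSemigroup using (interchange)
  open import Data.List using (List; []; _∷_; [_]; map; _++_; length; filter; lookup; allFin)
  import Data.List.Properties as Listₚ
  open import Data.List.Membership.Propositional.Properties using (∈-lookup; ∈-∃++; ∈-allFin)
  open import Data.List.Relation.Unary.All as All using ([]; _∷_)
  import Data.List.Relation.Unary.All.Properties as Allₚ
  open import Data.List.Relation.Unary.AllPairs using ([]; _∷_)
  open import Data.List.Relation.Unary.Any as Any using (here; there)
  open import Data.List.Relation.Unary.Linked using (Linked; []; [-]; _∷_)
  open import Data.List.Relation.Unary.Unique.Propositional using (Unique)
  open import Data.Nat as ℕ using (ℕ; zero; suc; s≤s)
  import Data.Nat.Properties as ℕₚ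
  open import Data.Nat.Divisibility
    using (_∣_; divides; _∣0; ∣-refl; ∣m∣n⇒∣m+n; ∣m+n∣m⇒∣n; ∣1⇒≡1)
  open import Data.Product using (_×_; _,_; proj₁; proj₂; ∃)
  open import Data.Sum as Sum using (_⊎_; inj₁; inj₂)
  open import Data.Vec using ([]; _∷_; insertAt; tabulate; here; there)
  open import Data.Vec.Properties using (lookup∘tabulate; lookup⇒[]=; []=⇒lookup)
  open import Function using (_∘_; case_of_)
  open import Function.Bundles using (mk⇔)
  open import Function.Construct.Identity using (↔-id)
  open import Relation.Nullary using (¬_; Dec; yes; no; does)
  open import Relation.Nullary.Decidable using (_×-dec_; _⊎-dec_; _→-dec_; ¬?; dec-true)
  open import Relation.Unary using (Decidable)
  open import Relation.Binary.Definitions using (tri<; tri≈; tri>)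
  open import Relation.Binary.PropositionalEquality
    using (_≡_; _≢_; refl; sym; trans; cong; cong₂; subst; subst₂; module ≡-Reasoning)

  -- Parity signs and sums over all subsets

  even⇒odd-suc : ∀ {k} → Even k → Odd (suc k)
  even⇒odd-suc {k} 2∣k 2∣1+k
    with () ← ∣1⇒≡1 (∣m+n∣m⇒∣n (subst (2 ∣_) (ℕₚ.+-comm 1 k) 2∣1+k) 2∣k)

  odd⇒even-suc : ∀ k → Odd k → Even (suc k)
  odd⇒even-suc zero    odd = ⊥-elim (odd (2 ∣0))
  odd⇒even-suc (suc k) odd with even? k
  ... | yes 2∣k = ∣m∣n⇒∣m+n ∣-refl 2∣k
  ... | no  odd-k = ⊥-elim (odd (odd⇒even-suc k odd-k))

  -- Signs are taken from Dec values, not from even? k itself: even? k normalises to a mod-helper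
  -- term that `with` cannot abstract, so the lemmas below case-split on Dec arguments.
  signOf : ∀ {A : Set} → Dec A → ℤ
  signOf a? = if does a? then 1ℤ else -1ℤ

  sign : ℕ → ℤ
  sign k = signOf (even? k)

  sign-suc : ∀ k → sign (suc k) ≡ - sign k
  sign-suc k = alternate (even? k) (even? (suc k))
    where
    alternate : (e? : Dec (Even k)) (e′? : Dec (Even (suc k))) → signOf e′? ≡ - signOf e?
    alternate (yes 2∣k) (yes 2∣1+k) = ⊥-elim (even⇒odd-suc 2∣k 2∣1+k)
    alternate (yes _)   (no _)      = refl
    alternate (no _)    (yes _)     = refl
    alternate (no odd)  (no odd′)   = ⊥-elim (odd′ (odd⇒even-suc k odd))

  signIf : ∀ {A : Set} → Dec A → ℕ → ℤ
  signIf a? k = if does a? then sign k else 0ℤ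

  signIf-cong : ∀ {A B : Set} (a? : Dec A) (b? : Dec B) {k} → (A → B) → (B → A) →
                signIf a? k ≡ signIf b? k
  signIf-cong (yes _) (yes _) _   _   = refl
  signIf-cong (yes a) (no ¬b) a→b _   = ⊥-elim (¬b (a→b a))
  signIf-cong (no ¬a) (yes b) _   b→a = ⊥-elim (¬a (b→a b))
  signIf-cong (no _)  (no _)  _   _   = refl

  signIf-suc : ∀ {A B : Set} (a? : Dec A) (b? : Dec B) {k} → (A → B) → (B → A) →
               signIf a? (suc k) ≡ - signIf b? k
  signIf-suc (yes _) (yes _) {k} _   _   = sign-suc k
  signIf-suc (yes a) (no ¬b)     a→b _   = ⊥-elim (¬b (a→b a))
  signIf-suc (no ¬a) (yes b)     _   b→a = ⊥-elim (¬a (b→a b))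
  signIf-suc (no _)  (no _)      _   _   = refl

  signIf-yes : ∀ {A : Set} (a? : Dec A) {k} → A → signIf a? k ≡ sign k
  signIf-yes (yes _) _ = refl
  signIf-yes (no ¬a) a = ⊥-elim (¬a a)

  signIf-no : ∀ {A : Set} (a? : Dec A) {k} → ¬ A → signIf a? k ≡ 0ℤ
  signIf-no (yes a) ¬a = ⊥-elim (¬a a)
  signIf-no (no _)  _  = refl

  sumSubsets : ∀ {n} → (Subset n → ℤ) → ℤ
  sumSubsets {zero}  f = f []
  sumSubsets {suc n} f = sumSubsets (f ∘ (true ∷_)) + sumSubsets (f ∘ (false ∷_))

  sumSubsets-cong : ∀ {n} {f g : Subset n → ℤ} → (∀ S → f S ≡ g S) → sumSubsets f ≡ sumSubsets g
  sumSubsets-cong {zero}  f≗g = f≗g []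
  sumSubsets-cong {suc n} f≗g =
    cong₂ _+_ (sumSubsets-cong (f≗g ∘ (true ∷_))) (sumSubsets-cong (f≗g ∘ (false ∷_)))

  sumSubsets-zero : ∀ {n} {f : Subset n → ℤ} → (∀ S → f S ≡ 0ℤ) → sumSubsets f ≡ 0ℤ
  sumSubsets-zero {zero}  f≗0 = f≗0 []
  sumSubsets-zero {suc n} f≗0 =
    cong₂ _+_ (sumSubsets-zero (f≗0 ∘ (true ∷_))) (sumSubsets-zero (f≗0 ∘ (false ∷_)))

  sumSubsets-+ : ∀ {n} (f g : Subset n → ℤ) →
                 sumSubsets (λ S → f S + g S) ≡ sumSubsets f + sumSubsets g
  sumSubsets-+ {zero}  f g = refl
  sumSubsets-+ {suc n} f g =
    trans (cong₂ _+_ (sumSubsets-+ (f ∘ (true ∷_)) (g ∘ (true ∷_)))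
                     (sumSubsets-+ (f ∘ (false ∷_)) (g ∘ (false ∷_))))
          (interchange (sumSubsets (f ∘ (true ∷_))) (sumSubsets (g ∘ (true ∷_)))
                       (sumSubsets (f ∘ (false ∷_))) (sumSubsets (g ∘ (false ∷_))))

  sumSubsets-neg : ∀ {n} (f : Subset n → ℤ) → sumSubsets (λ S → - f S) ≡ - sumSubsets f
  sumSubsets-neg {zero}  f = refl
  sumSubsets-neg {suc n} f =
    trans (cong₂ _+_ (sumSubsets-neg (f ∘ (true ∷_))) (sumSubsets-neg (f ∘ (false ∷_))))
          (sym (ℤₚ.neg-distrib-+ (sumSubsets (f ∘ (true ∷_))) (sumSubsets (f ∘ (false ∷_)))))

  sumSubsets-- : ∀ {n} (f g : Subset n → ℤ) →
                 sumSubsets (λ S → f S - g S) ≡ sumSubsets f - sumSubsets g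
  sumSubsets-- f g = trans (sumSubsets-+ f (λ S → - g S)) (cong (λ x → sumSubsets f + x) (sumSubsets-neg g))

  sumSubsets-insertAt : ∀ {n} (v : Fin (suc n)) (f : Subset (suc n) → ℤ) →
    sumSubsets f ≡ sumSubsets (λ S → f (insertAt S v true)) + sumSubsets (λ S → f (insertAt S v false))
  sumSubsets-insertAt         zero    f = refl
  sumSubsets-insertAt {suc n} (suc v) f =
    trans (cong₂ _+_ (sumSubsets-insertAt v (f ∘ (true ∷_))) (sumSubsets-insertAt v (f ∘ (false ∷_))))
          (interchange (sumSubsets λ S → f (true ∷ insertAt S v true))
                       (sumSubsets λ S → f (true ∷ insertAt S v false))
                       (sumSubsets λ S → f (false ∷ insertAt S v true))
                       (sumSubsets λ S → f (false ∷ insertAt S v false)))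

  sumSubsets-⊥ : ∀ {n} (f : Subset n → ℤ) → (∀ S → Nonempty S → f S ≡ 0ℤ) →
                 sumSubsets f ≡ f ⊥
  sumSubsets-⊥ {zero}  f _ = refl
  sumSubsets-⊥ {suc n} f vanishes =
    trans (cong₂ _+_ (sumSubsets-zero λ S → vanishes (true ∷ S) (zero , here))
                     (sumSubsets-⊥ (f ∘ (false ∷_)) λ S (x , x∈S) →
                                     vanishes (false ∷ S) (suc x , there x∈S)))
          (ℤₚ.+-identityˡ _)

  sumSubsets-sign : ∀ {n} → sumSubsets {suc n} (sign ∘ ∣_∣) ≡ 0ℤ
  sumSubsets-sign {n} =
    trans (cong (_+ sumSubsets {n} (sign ∘ ∣_∣))
                (trans (sumSubsets-cong {n} (sign-suc ∘ ∣_∣)) (sumSubsets-neg {n} (sign ∘ ∣_∣))))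
          (ℤₚ.+-inverseˡ (sumSubsets {n} (sign ∘ ∣_∣)))

  indicator : ∀ {A : Set} → Dec A → ℤ
  indicator a? = if does a? then 1ℤ else 0ℤ

  count : ∀ {n} {P : Subset n → Set} → Decidable P → ℕ
  count {n} P? = length (filter P? (allSubsets n))

  length-filter-map : ∀ {A B : Set} {P : B → Set} (P? : Decidable P) (g : A → B) xs →
                      length (filter P? (map g xs)) ≡ length (filter (P? ∘ g) xs)
  length-filter-map P? g []       = refl
  length-filter-map P? g (x ∷ xs) with does (P? (g x))
  ... | true  = cong suc (length-filter-map P? g xs)
  ... | false = length-filter-map P? g xs

  length-filter-split : ∀ {A : Set} {P Q : A → Set} (P? : Decidable P) (Q? : Decidable Q) xs →
    length (filter P? xs) ≡
    length (filter (λ x → P? x ×-dec Q? x) xs) ℕ.+ length (filter (λ x → P? x ×-dec ¬? (Q? x)) xs)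
  length-filter-split P? Q? []       = refl
  length-filter-split P? Q? (x ∷ xs) with P? x | Q? x
  ... | yes _ | yes _ = cong suc (length-filter-split P? Q? xs)
  ... | yes _ | no _  = trans (cong suc (length-filter-split P? Q? xs)) (sym (ℕₚ.+-suc _ _))
  ... | no _  | _     = length-filter-split P? Q? xs

  count-as-sum : ∀ {n} {P : Subset n → Set} (P? : Decidable P) → + count P? ≡ sumSubsets (indicator ∘ P?)
  count-as-sum {zero}  P? with P? []
  ... | yes _ = refl
  ... | no _  = refl
  count-as-sum {suc n} P? = begin
    + length (filter P? (map (true ∷_) (allSubsets n) ++ map (false ∷_) (allSubsets n)))
      ≡⟨ cong (+_) (trans (cong length (Listₚ.filter-++ P? (map (true ∷_) (allSubsets n)) _))
                          (Listₚ.length-++ (filter P? (map (true ∷_) (allSubsets n))))) ⟩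
    + (length (filter P? (map (true ∷_) (allSubsets n))) ℕ.+ length (filter P? (map (false ∷_) (allSubsets n))))
      ≡⟨ cong (+_) (cong₂ ℕ._+_ (length-filter-map P? (true ∷_) (allSubsets n))
                                (length-filter-map P? (false ∷_) (allSubsets n))) ⟩
    + (count (P? ∘ (true ∷_)) ℕ.+ count (P? ∘ (false ∷_)))
      ≡⟨ ℤₚ.pos-+ (count (P? ∘ (true ∷_))) (count (P? ∘ (false ∷_))) ⟩
    + count (P? ∘ (true ∷_)) + + count (P? ∘ (false ∷_))
      ≡⟨ cong₂ _+_ (count-as-sum (P? ∘ (true ∷_))) (count-as-sum (P? ∘ (false ∷_))) ⟩
    sumSubsets (indicator ∘ P?) ∎
    where open ≡-Reasoning

  ifSign-as-indicators : ∀ {X A E : Set} (x? : Dec X) → X → (a? : Dec A) (e? : Dec E) →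
    (if does (x? ×-dec a?) then signOf e? else 0ℤ) ≡ indicator (a? ×-dec e?) - indicator (a? ×-dec ¬? e?)
  ifSign-as-indicators (no ¬x) x _       _       = ⊥-elim (¬x x)
  ifSign-as-indicators (yes _) _ (yes _) (yes _) = refl
  ifSign-as-indicators (yes _) _ (yes _) (no _)  = refl
  ifSign-as-indicators (yes _) _ (no _)  (yes _) = refl
  ifSign-as-indicators (yes _) _ (no _)  (no _)  = refl

  complement-as-indicators : ∀ {X A E : Set} (x? : Dec X) → X → (a? : Dec A) (e? : Dec E) →
    indicator (¬? a? ×-dec e?) - indicator (¬? a? ×-dec ¬? e?) ≡
    signOf e? - (if does (x? ×-dec a?) then signOf e? else 0ℤ)
  complement-as-indicators (no ¬x) x _       _       = ⊥-elim (¬x x)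
  complement-as-indicators (yes _) _ (yes _) (yes _) = refl
  complement-as-indicators (yes _) _ (yes _) (no _)  = refl
  complement-as-indicators (yes _) _ (no _)  (yes _) = refl
  complement-as-indicators (yes _) _ (no _)  (no _)  = refl

  x∈p─q⇒x∉q : ∀ {n} {p q : Subset n} {x} → x ∈ p ─ q → x ∉ q
  x∈p─q⇒x∉q {p = _ ∷ p} {_ ∷ q} (there x∈p─q) (there x∈q) = x∈p─q⇒x∉q x∈p─q x∈q

  ∈-tabulate⁺ : ∀ {n} {P : Fin n → Set} (P? : Decidable P) {x} → P x → x ∈ tabulate (does ∘ P?)
  ∈-tabulate⁺ P? {x} px = lookup⇒[]= x _ (trans (lookup∘tabulate (does ∘ P?) x) (dec-true (P? x) px))

  ∈-tabulate⁻ : ∀ {n} {P : Fin n → Set} (P? : Decidable P) {x} → x ∈ tabulate (does ∘ P?) → P x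
  ∈-tabulate⁻ P? {x} x∈ with P? x | trans (sym (lookup∘tabulate (does ∘ P?) x)) ([]=⇒lookup x∈)
  ... | yes px | _ = px

  ∈-⁅x⁆∪p⁻ : ∀ {n} {x y : Fin n} {p} → y ∈ ⁅ x ⁆ ∪ p → y ≡ x ⊎ y ∈ p
  ∈-⁅x⁆∪p⁻ {x = x} {p = p} y∈ = Sum.map₁ (x∈⁅y⁆⇒x≡y x) (x∈p∪q⁻ ⁅ x ⁆ p y∈)

  x∈⁅x⁆∪p : ∀ {n} (x : Fin n) {p} → x ∈ ⁅ x ⁆ ∪ p
  x∈⁅x⁆∪p x {p} = p⊆p∪q p (x∈⁅x⁆ x)

  p⊆⁅x⁆∪p : ∀ {n} (x : Fin n) {p} → p ⊆ ⁅ x ⁆ ∪ p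
  p⊆⁅x⁆∪p x {p} = q⊆p∪q ⁅ x ⁆ p

  ∣⁅x⁆∪p∣ : ∀ {n} {x : Fin n} {p} → x ∉ p → ∣ ⁅ x ⁆ ∪ p ∣ ≡ suc ∣ p ∣
  ∣⁅x⁆∪p∣ {x = zero}  {outside ∷ p} _   = cong (suc ∘ ∣_∣) (∪-identityˡ p)
  ∣⁅x⁆∪p∣ {x = zero}  {inside ∷ p}  x∉p = ⊥-elim (x∉p here)
  ∣⁅x⁆∪p∣ {x = suc x} {outside ∷ p} x∉p = ∣⁅x⁆∪p∣ (x∉p ∘ there)
  ∣⁅x⁆∪p∣ {x = suc x} {inside ∷ p}  x∉p = cong suc (∣⁅x⁆∪p∣ (x∉p ∘ there))

  x∈p-y⁻ : ∀ {n} {p : Subset n} {x y} → x ∈ p ─ ⁅ y ⁆ → x ∈ p × x ≢ y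
  x∈p-y⁻ {p = p} {y = y} x∈ =
    p─q⊆p p ⁅ y ⁆ x∈ , λ { refl → x∈p─q⇒x∉q x∈ (x∈⁅x⁆ y) }

  insertAt-∈-self : ∀ {n} (S : Subset n) v → v ∈ insertAt S v true
  insertAt-∈-self S       zero    = here
  insertAt-∈-self (_ ∷ S) (suc v) = there (insertAt-∈-self S v)

  insertAt-∉-self : ∀ {n} (S : Subset n) v → v ∉ insertAt S v false
  insertAt-∉-self (_ ∷ S) (suc v) (there v∈) = insertAt-∉-self S v v∈

  insertAt-∈-other : ∀ {n} (S : Subset n) {v x} b b′ → x ≢ v →
                     x ∈ insertAt S v b → x ∈ insertAt S v b′
  insertAt-∈-other S       {zero}  {zero}  _ _ x≢v _          = ⊥-elim (x≢v refl)
  insertAt-∈-other S       {zero}  {suc x} _ _ _   (there x∈) = there x∈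
  insertAt-∈-other (_ ∷ S) {suc v} {zero}  _ _ _   here       = here
  insertAt-∈-other (_ ∷ S) {suc v} {suc x} b b′ x≢v (there x∈) =
    there (insertAt-∈-other S b b′ (x≢v ∘ cong suc) x∈)

  insertAt-∈⁻ : ∀ {n} (S : Subset n) {v x} → x ∈ insertAt S v true → x ≡ v ⊎ x ∈ insertAt S v false
  insertAt-∈⁻ S {v} {x} x∈ with x ≟ v
  ... | yes x≡v = inj₁ x≡v
  ... | no  x≢v = inj₂ (insertAt-∈-other S true false x≢v x∈)

  ∣insertAt∣ : ∀ {n} (S : Subset n) v → ∣ insertAt S v true ∣ ≡ suc ∣ insertAt S v false ∣
  ∣insertAt∣ S              zero    = refl
  ∣insertAt∣ (inside ∷ S)  (suc v) = cong suc (∣insertAt∣ S v)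
  ∣insertAt∣ (outside ∷ S) (suc v) = ∣insertAt∣ S v

  Unique⇒length≤ : ∀ {n} {xs : List (Fin n)} → Unique xs → length xs ℕ.≤ n
  Unique⇒length≤ {n} {xs} unique with length xs ℕ.≤? n
  ... | yes ≤n = ≤n
  ... | no ≰n with i , j , i<j , lookupᵢ≡lookupⱼ ← pigeonhole (ℕₚ.≰⇒> ≰n) (lookup xs) =
    ⊥-elim (distinct unique i<j lookupᵢ≡lookupⱼ)
    where
    distinct : ∀ {A : Set} {xs : List A} → Unique xs → ∀ {i j} → i Fin.< j → lookup xs i ≢ lookup xs j
    distinct (x≢xs ∷ _) {zero}  {suc j} _         = All.lookup x≢xs (∈-lookup j)
    distinct (_ ∷ unique) {suc i} {suc j} (s≤s i<j) = distinct unique i<j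

  unique-rotate : ∀ {A : Set} (xs : List A) {y zs} → Unique (xs ++ y ∷ zs) → Unique (y ∷ xs)
  unique-rotate []       _                = [] ∷ []
  unique-rotate (x ∷ xs) {y} (x≢rest ∷ unique) with unique-rotate xs unique
  ... | y≢xs ∷ unique′ = (y≢x ∷ y≢xs) ∷ Allₚ.++⁻ˡ xs x≢rest ∷ unique′
    where
    y≢x : y ≢ x
    y≢x refl with x≢y ∷ _ ← Allₚ.++⁻ʳ xs x≢rest = x≢y refl

  linked-prefix : ∀ {A : Set} {R : A → A → Set} (xs : List A) {y zs} →
                  Linked R (xs ++ y ∷ zs) → Linked R (xs ++ [ y ])
  linked-prefix []           _            = [-]
  linked-prefix (x ∷ [])     (Rxy ∷ _)    = Rxy ∷ [-]
  linked-prefix (x ∷ x′ ∷ xs) (Rxx′ ∷ rest) = Rxx′ ∷ linked-prefix (x′ ∷ xs) rest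

  -- The alternating count and its deletion recurrence

  module _ {n} (G : Graph n) where

    closedNbhd? : ∀ v x → Dec (x ≡ v ⊎ Adj G v x)
    closedNbhd? v x = x ≟ v ⊎-dec adj? G v x

    closedNbhd : Fin n → Subset n
    closedNbhd v = tabulate (does ∘ closedNbhd? v)

    ∈─closedNbhd⁺ : ∀ {W v x} → x ∈ W → x ≢ v → ¬ Adj G v x → x ∈ W ─ closedNbhd v
    ∈─closedNbhd⁺ x∈W x≢v v≁x =
      x∈p∧x∉q⇒x∈p─q x∈W (Sum.[ x≢v , v≁x ] ∘ ∈-tabulate⁻ (closedNbhd? _))

    ∈─closedNbhd⁻ : ∀ {W v x} → x ∈ W ─ closedNbhd v → x ∈ W × x ≢ v × ¬ Adj G v x
    ∈─closedNbhd⁻ {W} {v} x∈ = p─q⊆p W (closedNbhd v) x∈ , x∉N ∘ inj₁ , x∉N ∘ inj₂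
      where x∉N = x∈p─q⇒x∉q x∈ ∘ ∈-tabulate⁺ (closedNbhd? v)

    StableIn : Subset n → Subset n → Set
    StableIn W S = S ⊆ W × Stable G S

    stableIn? : ∀ W S → Dec (StableIn W S)
    stableIn? W S = S ⊆? W ×-dec stable? G S

    stableSign : Subset n → Subset n → ℤ
    stableSign W S = signIf (stableIn? W S) ∣ S ∣

    alternatingCount : Subset n → ℤ
    alternatingCount W = sumSubsets (stableSign W)

    stableSign-∉ : ∀ {W S x} → x ∈ S → x ∉ W → stableSign W S ≡ 0ℤ
    stableSign-∉ {W} {S} x∈S x∉W = signIf-no (stableIn? W S) {∣ S ∣} λ (S⊆W , _) → x∉W (S⊆W x∈S)

    alternatingCount-empty : ∀ {W} → Empty W → alternatingCount W ≡ 1ℤ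
    alternatingCount-empty W-empty with refl ← Empty-unique W-empty =
      trans (sumSubsets-⊥ (stableSign ⊥) λ S (x , x∈S) → stableSign-∉ x∈S ∉⊥)
            (trans (signIf-yes (stableIn? ⊥ ⊥) {∣ ⊥ {n} ∣} (⊥⊆ , λ _ _ a∈⊥ → ⊥-elim (∉⊥ a∈⊥)))
                   (cong sign (∣⊥∣≡0 n)))

    stable-⊆ : ∀ {S S′} → S ⊆ S′ → Stable G S′ → Stable G S
    stable-⊆ S⊆S′ stable a b a∈S b∈S = stable a b (S⊆S′ a∈S) (S⊆S′ b∈S)

    stable-insert : ∀ {S S′ v} → (∀ {x} → x ∈ S′ → x ≡ v ⊎ x ∈ S) →
                    Stable G S → (∀ {x} → x ∈ S → ¬ Adj G v x) → Stable G S′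
    stable-insert split stable v≁S a b a∈ b∈ with split a∈ | split b∈
    ... | inj₁ refl | inj₁ refl = Adj-irrefl G refl
    ... | inj₁ refl | inj₂ b∈S  = v≁S b∈S
    ... | inj₂ a∈S  | inj₁ refl = v≁S a∈S ∘ Adj-sym G
    ... | inj₂ a∈S  | inj₂ b∈S  = stable a b a∈S b∈S

    stableIn-insertCentre : ∀ {W S S′ v} → (∀ {x} → x ∈ S′ → x ≡ v ⊎ x ∈ S) → v ∈ W →
                            StableIn (W ─ closedNbhd v) S → StableIn W S′
    stableIn-insertCentre split v∈W (S⊆R , stable) =
      (λ x∈ → Sum.[ (λ { refl → v∈W }) , proj₁ ∘ ∈─closedNbhd⁻ ∘ S⊆R ] (split x∈)) ,
      stable-insert split stable (proj₂ ∘ proj₂ ∘ ∈─closedNbhd⁻ ∘ S⊆R)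

  module _ {m} (G : Graph (suc m)) where

    alternatingCount-avoiding : ∀ {W} v → v ∉ W →
      alternatingCount G W ≡ sumSubsets (λ S → stableSign G W (insertAt S v false))
    alternatingCount-avoiding {W} v v∉W =
      trans (sumSubsets-insertAt v (stableSign G W))
            (trans (cong (_+ sumSubsets (λ S → stableSign G W (insertAt S v false)))
                         (sumSubsets-zero λ S → stableSign-∉ G (insertAt-∈-self S v) v∉W))
                   (ℤₚ.+-identityˡ _))

    -- Stable sets S ∌ v of G[W] are those of G[W − v]; those with v ∈ S are v plus a stable set
    -- of G[W − N[v]], with the opposite sign.
    alternatingCount-delete : ∀ {W v} → v ∈ W →
      alternatingCount G W ≡ alternatingCount G (W ─ ⁅ v ⁆) - alternatingCount G (W ─ closedNbhd G v)
    alternatingCount-delete {W} {v} v∈W = begin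
      alternatingCount G W
        ≡⟨ sumSubsets-insertAt v (stableSign G W) ⟩
      sumSubsets (stableSign G W ∘ S₁) + sumSubsets (stableSign G W ∘ S₀)
        ≡⟨ cong₂ _+_ (trans (sumSubsets-cong with-v) (sumSubsets-neg (stableSign G R ∘ S₀)))
                     (sumSubsets-cong without-v) ⟩
      - sumSubsets (stableSign G R ∘ S₀) + sumSubsets (stableSign G (W ─ ⁅ v ⁆) ∘ S₀)
        ≡⟨ ℤₚ.+-comm (- sumSubsets (stableSign G R ∘ S₀)) _ ⟩
      sumSubsets (stableSign G (W ─ ⁅ v ⁆) ∘ S₀) - sumSubsets (stableSign G R ∘ S₀)
        ≡⟨ sym (cong₂ _-_ (alternatingCount-avoiding v (λ v∈ → x∈p─q⇒x∉q v∈ (x∈⁅x⁆ v)))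
                          (alternatingCount-avoiding v λ v∈R → proj₁ (proj₂ (∈─closedNbhd⁻ G v∈R)) refl)) ⟩
      alternatingCount G (W ─ ⁅ v ⁆) - alternatingCount G R ∎
      where
      open ≡-Reasoning
      R = W ─ closedNbhd G v
      S₀ S₁ : Subset m → Subset (suc m)
      S₀ S = insertAt S v false
      S₁ S = insertAt S v true

      with-v : ∀ S → stableSign G W (S₁ S) ≡ - stableSign G R (S₀ S)
      with-v S = trans (cong (signIf (stableIn? G W (S₁ S))) (∣insertAt∣ S v))
                       (signIf-suc (stableIn? G W (S₁ S)) (stableIn? G R (S₀ S)) {∣ S₀ S ∣} remove-v add-v)
        where
        x≢v : ∀ {x} → x ∈ S₀ S → x ≢ v
        x≢v x∈ refl = insertAt-∉-self S v x∈
        S₀⊆S₁ : S₀ S ⊆ S₁ S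
        S₀⊆S₁ x∈ = insertAt-∈-other S false true (x≢v x∈) x∈
        remove-v : StableIn G W (S₁ S) → StableIn G R (S₀ S)
        remove-v (S₁⊆W , stable) =
          (λ x∈ → ∈─closedNbhd⁺ G (S₁⊆W (S₀⊆S₁ x∈)) (x≢v x∈)
                                   (stable v _ (insertAt-∈-self S v) (S₀⊆S₁ x∈))) ,
          stable-⊆ G S₀⊆S₁ stable
        add-v : StableIn G R (S₀ S) → StableIn G W (S₁ S)
        add-v = stableIn-insertCentre G (insertAt-∈⁻ S) v∈W

      without-v : ∀ S → stableSign G W (S₀ S) ≡ stableSign G (W ─ ⁅ v ⁆) (S₀ S)
      without-v S = signIf-cong (stableIn? G W (S₀ S)) (stableIn? G (W ─ ⁅ v ⁆) (S₀ S)) {∣ S₀ S ∣}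
        (λ (S₀⊆W , stable) →
           (λ x∈ → x∈p∧x≢y⇒x∈p-y (S₀⊆W x∈) λ { refl → insertAt-∉-self S v x∈ }) , stable)
        (λ (S₀⊆W-v , stable) → p─q⊆p W ⁅ v ⁆ ∘ S₀⊆W-v , stable)

  -- Forests

  module _ {n} (G : Graph n) where

    OnlyNeighbour : Subset n → Fin n → Fin n → Set
    OnlyNeighbour W x p = ∀ y → y ∈ W → Adj G x y → y ≡ p

    onlyNeighbour? : ∀ W x p → Dec (OnlyNeighbour W x p)
    onlyNeighbour? W x p = all? λ y → (y ∈? W) →-dec (adj? G x y →-dec (y ≟ p))

    Isolated : Subset n → Fin n → Set
    Isolated W x = x ∈ W × (∀ y → y ∈ W → ¬ Adj G x y)

    record Leaf (W : Subset n) (u v : Fin n) : Set where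
      field
        u∈W    : u ∈ W
        v∈W    : v ∈ W
        u~v    : Adj G u v
        only-v : OnlyNeighbour W u v

    leaf-lift : ∀ {R W x y} → R ⊆ W → Leaf R x y → (∀ z → z ∈ W → Adj G x z → z ∈ R) →
                Leaf W x y
    leaf-lift R⊆W x-leaf neighbours-in-R = record
      { u∈W = R⊆W u∈W ; v∈W = R⊆W v∈W ; u~v = u~v
      ; only-v = λ z z∈W x~z → only-v z (neighbours-in-R z z∈W x~z) x~z }
      where open Leaf x-leaf

    MinDegree≥2 : Subset n → Set
    MinDegree≥2 W = ∀ {x} → x ∈ W → ∀ p → ∃ λ y → y ∈ W × Adj G x y × y ≢ p

    ¬onlyNeighbour⇒other : ∀ {W x p} → ¬ OnlyNeighbour W x p → ∃ λ y → y ∈ W × Adj G x y × y ≢ p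
    ¬onlyNeighbour⇒other {W} {x} {p} ¬only
      with y , ¬only-y ← ¬∀⟶∃¬ n _ (λ y → (y ∈? W) →-dec (adj? G x y →-dec (y ≟ p))) ¬only
      with y ∈? W | adj? G x y | y ≟ p
    ... | yes y∈W | yes x~y | no y≢p   = y , y∈W , x~y , y≢p
    ... | yes _   | yes _   | yes y≡p  = ⊥-elim (¬only-y λ _ _ → y≡p)
    ... | yes _   | no x≁y  | _        = ⊥-elim (¬only-y λ _ x~y → ⊥-elim (x≁y x~y))
    ... | no y∉W  | _       | _        = ⊥-elim (¬only-y λ y∈W → ⊥-elim (y∉W y∈W))

    minDegree≥2⇒HasCycle : ∀ {W} → MinDegree≥2 W → Nonempty W → HasCycle G
    minDegree≥2⇒HasCycle {W} degree (x , x∈W) =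
      extend n [] x∈W ([] ∷ []) [-] (ℕₚ.m<m+n n ℕ.z<s)
      where
      previous : Fin n → List (Fin n) → Fin n
      previous tip []      = tip
      previous _   (q ∷ _) = q

      closeCycle : ∀ {x y} path → Unique (x ∷ path) → Linked (Adj G) (x ∷ path) →
                   Adj G x y → y ≢ previous x path → Any.Any (y ≡_) path → HasCycle G
      closeCycle (q ∷ _) _ _ _ y≢q (here y≡q) = ⊥-elim (y≢q y≡q)
      closeCycle {x} {y} (q ∷ _) unique linked x~y _ (there y∈path)
        with ys , zs , refl ← ∈-∃++ y∈path =
        y , x ∷ q ∷ ys , s≤s (s≤s ℕ.z≤n) , unique-rotate (x ∷ q ∷ ys) unique ,
        Adj-sym G x~y ∷ linked-prefix (x ∷ q ∷ ys) linked

      -- The path x ∷ path is stored tip first; the fuel k bounds its growth, as a path has at most n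
      -- vertices.
      extend : ∀ k {x} path → x ∈ W → Unique (x ∷ path) → Linked (Adj G) (x ∷ path) →
               n ℕ.< k ℕ.+ length (x ∷ path) → HasCycle G
      extend zero    path _ unique _ n<length = ⊥-elim (ℕₚ.<⇒≱ n<length (Unique⇒length≤ unique))
      extend (suc k) {x} path x∈W unique linked n<length
        with y , y∈W , x~y , y≢previous ← degree x∈W (previous x path)
        with Any.any? (y ≟_) (x ∷ path)
      ... | no y∉ = extend k (x ∷ path) y∈W (Allₚ.¬Any⇒All¬ _ y∉ ∷ unique) (Adj-sym G x~y ∷ linked)
                      (subst (n ℕ.<_) (sym (ℕₚ.+-suc k _)) n<length)
      ... | yes (here y≡x)      = ⊥-elim (Adj-irrefl G (sym y≡x) x~y)
      ... | yes (there y∈path) = closeCycle path unique linked x~y y≢previous y∈path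

    data ForestView (W : Subset n) : Set where
      empty    : Empty W → ForestView W
      isolated : ∀ {x} → Isolated W x → ForestView W
      leaf     : ∀ {u v} → Leaf W u v → ForestView W

    forestView : Acyclic G → ∀ W → ForestView W
    forestView acyclic W with nonempty? W
    ... | no W-empty = empty W-empty
    ... | yes W-nonempty with any? (λ x → (x ∈? W) ×-dec any? (onlyNeighbour? W x))
    ...   | no noLeaf = ⊥-elim (acyclic (minDegree≥2⇒HasCycle minDegree≥2 W-nonempty))
      where
      minDegree≥2 : MinDegree≥2 W
      minDegree≥2 {x} x∈W p = ¬onlyNeighbour⇒other λ only-p → noLeaf (x , x∈W , p , only-p)
    ...   | yes (u , u∈W , v , only-v) with any? (λ y → (y ∈? W) ×-dec adj? G u y)
    ...     | no noNeighbour = isolated (u∈W , λ y y∈W u~y → noNeighbour (y , y∈W , u~y))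
    ...     | yes (y , y∈W , u~y) with refl ← only-v y y∈W u~y =
      leaf record { u∈W = u∈W ; v∈W = y∈W ; u~v = u~y ; only-v = only-v }

    ─closedNbhd⊂ : ∀ {W v} → v ∈ W → W ─ closedNbhd G v ⊂ W
    ─closedNbhd⊂ {W} {v} v∈W =
      p∩q≢∅⇒p─q⊂p W (closedNbhd G v) (v , x∈p∩q⁺ (v∈W , ∈-tabulate⁺ (closedNbhd? G v) (inj₁ refl)))

  module _ {m} (G : Graph (suc m)) where

    alternatingCount-isolated : ∀ {W x} → Isolated G W x → alternatingCount G W ≡ 0ℤ
    alternatingCount-isolated {W} {x} (x∈W , x-isolated) = begin
      alternatingCount G W
        ≡⟨ alternatingCount-delete G x∈W ⟩
      alternatingCount G (W ─ ⁅ x ⁆) - alternatingCount G (W ─ closedNbhd G x)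
        ≡⟨ cong (λ W′ → alternatingCount G W′ - alternatingCount G (W ─ closedNbhd G x)) W-x≡W-N[x] ⟩
      alternatingCount G (W ─ closedNbhd G x) - alternatingCount G (W ─ closedNbhd G x)
        ≡⟨ ℤₚ.+-inverseʳ (alternatingCount G (W ─ closedNbhd G x)) ⟩
      0ℤ ∎
      where
      open ≡-Reasoning
      W-x≡W-N[x] : W ─ ⁅ x ⁆ ≡ W ─ closedNbhd G x
      W-x≡W-N[x] = ⊆-antisym
        (λ y∈ → let y∈W , y≢x = x∈p-y⁻ y∈ in ∈─closedNbhd⁺ G y∈W y≢x (x-isolated _ y∈W))
        (λ y∈ → let y∈W , y≢x , _ = ∈─closedNbhd⁻ G y∈ in x∈p∧x≢y⇒x∈p-y y∈W y≢x)

    alternatingCount-leaf : ∀ {W u v} → Leaf G W u v →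
                            alternatingCount G W ≡ - alternatingCount G (W ─ closedNbhd G v)
    alternatingCount-leaf {W} {u} {v} u-leaf =
      trans (alternatingCount-delete G v∈W)
            (trans (cong (_- alternatingCount G (W ─ closedNbhd G v)) (alternatingCount-isolated u-isolated))
                   (ℤₚ.+-identityˡ _))
      where
      open Leaf u-leaf
      u-isolated : Isolated G (W ─ ⁅ v ⁆) u
      u-isolated = x∈p∧x≢y⇒x∈p-y u∈W (λ u≡v → Adj-irrefl G u≡v u~v) ,
                   λ y y∈ u~y → let y∈W , y≢v = x∈p-y⁻ y∈ in y≢v (only-v y y∈W u~y)

    ∣alternatingCount∣≤1 : Acyclic G → ∀ W → ℤ.∣ alternatingCount G W ∣ ℕ.≤ 1
    ∣alternatingCount∣≤1 acyclic W = go W (⊂-wellFounded W)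
      where
      go : ∀ W → Acc _⊂_ W → ℤ.∣ alternatingCount G W ∣ ℕ.≤ 1
      go W (acc smaller) with forestView G acyclic W
      ... | empty W-empty = ℕₚ.≤-reflexive (cong ℤ.∣_∣ (alternatingCount-empty G W-empty))
      ... | isolated x-isolated =
        subst (ℕ._≤ 1) (sym (cong ℤ.∣_∣ (alternatingCount-isolated x-isolated))) ℕ.z≤n
      ... | leaf {v = v} u-leaf =
        subst (ℕ._≤ 1) (sym (trans (cong ℤ.∣_∣ (alternatingCount-leaf u-leaf))
                                   (ℤₚ.∣-i∣≡∣i∣ (alternatingCount G (W ─ closedNbhd G v)))))
              (go _ (smaller (─closedNbhd⊂ G (Leaf.v∈W u-leaf))))

  -- Well-covered forests

  module _ {n} (G : Graph n) where

    Covered : Subset n → Fin n → Set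
    Covered M x = x ∈ M ⊎ ∃ λ y → y ∈ M × Adj G x y

    covered? : ∀ M x → Dec (Covered M x)
    covered? M x = (x ∈? M) ⊎-dec any? (λ y → (y ∈? M) ×-dec adj? G x y)

    covered-mono : ∀ {M M′ x} → M ⊆ M′ → Covered M x → Covered M′ x
    covered-mono M⊆M′ = Sum.map M⊆M′ λ (y , y∈M , x~y) → y , M⊆M′ y∈M , x~y

    MaximalStableIn : Subset n → Subset n → Set
    MaximalStableIn W M = StableIn G W M × (∀ {x} → x ∈ W → Covered M x)

    -- For W = ⊤ this is WellCovered G, because every stable set extends to a maximal one.
    WellCoveredIn : Subset n → Set
    WellCoveredIn W = ∀ {S M} → StableIn G W S → MaximalStableIn W M → ∣ S ∣ ℕ.≤ ∣ M ∣

    OneRegular : Subset n → Set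
    OneRegular W = ∀ {x} → x ∈ W → ∃ (Leaf G W x)

    greedyExtension : ∀ (L : List (Fin n)) {S} → Stable G S →
      ∃ λ M → Stable G M × S ⊆ M × (∀ {x} → Any.Any (x ≡_) L → Covered M x)
    greedyExtension []      stable = _ , stable , (λ x∈S → x∈S) , λ ()
    greedyExtension (x ∷ L) {S} stable with covered? S x
    ... | yes x-covered with M , M-stable , S⊆M , L-covered ← greedyExtension L stable =
      M , M-stable , S⊆M , λ { (here refl) → covered-mono S⊆M x-covered ; (there y∈L) → L-covered y∈L }
    ... | no x-uncovered
      with M , M-stable , S+x⊆M , L-covered ←
           greedyExtension L (stable-insert G ∈-⁅x⁆∪p⁻ stable λ y∈S x~y →
                                x-uncovered (inj₂ (_ , y∈S , x~y))) =
      M , M-stable , S+x⊆M ∘ p⊆⁅x⁆∪p x ,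
      λ { (here refl) → inj₁ (S+x⊆M (x∈⁅x⁆∪p x)) ; (there y∈L) → L-covered y∈L }

    extendToMaximal : ∀ {S} → Stable G S → ∃ λ M → S ⊆ M × MaximalStableIn ⊤ M
    extendToMaximal stable with M , M-stable , S⊆M , covered ← greedyExtension (allFin n) stable =
      M , S⊆M , (⊆⊤ , M-stable) , λ {x} _ → covered (∈-allFin x)

    maximalStableIn⊤⇒MaximalStable : ∀ {M} → MaximalStableIn ⊤ M → MaximalStable G M
    maximalStableIn⊤⇒MaximalStable {M} ((_ , M-stable) , covered) =
      M-stable , λ T M⊆T T-stable → ⊆-antisym (T⊆M M⊆T T-stable) M⊆T
      where
      T⊆M : ∀ {T} → M ⊆ T → Stable G T → T ⊆ M
      T⊆M M⊆T T-stable {x} x∈T with covered ∈⊤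
      ... | inj₁ x∈M             = x∈M
      ... | inj₂ (y , y∈M , x~y) = ⊥-elim (T-stable x y x∈T (M⊆T y∈M) x~y)

    wellCovered⇒wellCoveredIn⊤ : WellCovered G → WellCoveredIn ⊤
    wellCovered⇒wellCoveredIn⊤ wellCovered (_ , S-stable) M-maximal
      with M′ , S⊆M′ , M′-maximal ← extendToMaximal S-stable =
      ℕₚ.≤-trans (p⊆q⇒∣p∣≤∣q∣ S⊆M′)
                 (ℕₚ.≤-reflexive (wellCovered _ _ (maximalStableIn⊤⇒MaximalStable M′-maximal)
                                                  (maximalStableIn⊤⇒MaximalStable M-maximal)))

    maximalStableIn-insertCentre : ∀ {W M v} → v ∈ W →
      MaximalStableIn (W ─ closedNbhd G v) M → MaximalStableIn W (⁅ v ⁆ ∪ M)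
    maximalStableIn-insertCentre {W} {M} {v} v∈W (M-stableIn , covered) =
      stableIn-insertCentre G ∈-⁅x⁆∪p⁻ v∈W M-stableIn , covered′
      where
      covered′ : ∀ {x} → x ∈ W → Covered (⁅ v ⁆ ∪ M) x
      covered′ {x} x∈W with x ≟ v | adj? G v x
      ... | yes refl | _       = inj₁ (x∈⁅x⁆∪p v)
      ... | no _     | yes v~x = inj₂ (v , x∈⁅x⁆∪p v , Adj-sym G v~x)
      ... | no x≢v   | no v≁x  = covered-mono (p⊆⁅x⁆∪p v) (covered (∈─closedNbhd⁺ G x∈W x≢v v≁x))

    ∣⁅v⁆∪S∣ : ∀ {W S v} → StableIn G (W ─ closedNbhd G v) S → ∣ ⁅ v ⁆ ∪ S ∣ ≡ suc ∣ S ∣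
    ∣⁅v⁆∪S∣ (S⊆R , _) =
      ∣⁅x⁆∪p∣ λ v∈S → proj₁ (proj₂ (∈─closedNbhd⁻ G (S⊆R v∈S))) refl

    wellCoveredIn-─closedNbhd : ∀ {W v} → v ∈ W → WellCoveredIn W → WellCoveredIn (W ─ closedNbhd G v)
    wellCoveredIn-─closedNbhd v∈W wellCovered S-stableIn M-maximal@(M-stableIn , _) =
      ℕ.s≤s⁻¹ (subst₂ ℕ._≤_ (∣⁅v⁆∪S∣ S-stableIn) (∣⁅v⁆∪S∣ M-stableIn)
        (wellCovered (stableIn-insertCentre G ∈-⁅x⁆∪p⁻ v∈W S-stableIn)
                     (maximalStableIn-insertCentre v∈W M-maximal)))

    acyclic⇒triangle-free : Acyclic G → ∀ {a b c} → Adj G a b → Adj G b c → ¬ Adj G a c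
    acyclic⇒triangle-free acyclic a~b b~c a~c = acyclic
      (_ , _ ∷ _ ∷ [] , s≤s (s≤s ℕ.z≤n) ,
       ((λ a≡b → Adj-irrefl G a≡b a~b) ∷ (λ a≡c → Adj-irrefl G a≡c a~c) ∷ []) ∷
       ((λ b≡c → Adj-irrefl G b≡c b~c) ∷ []) ∷ [] ∷ [] ,
       a~b ∷ b~c ∷ Adj-sym G a~c ∷ [-])

  module SupportVertex {n} (G : Graph n) (acyclic : Acyclic G) {W u v}
    (u-leaf : Leaf G W u v) (R-regular : OneRegular G (W ─ closedNbhd G v))
    {w} (w∈W : w ∈ W) (v~w : Adj G v w) where

    open Leaf u-leaf

    R : Subset n
    R = W ─ closedNbhd G v

    -- From each edge {r, s} of the perfect matching G[R], B takes an endpoint not adjacent to w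
    -- (one exists, as G has no triangle), the smaller one if both qualify.
    Chosen : Fin n → Set
    Chosen r = r ∈ R × ¬ Adj G w r × (∀ s → s ∈ R → Adj G r s → Adj G w s ⊎ r Fin.< s)

    chosen? : Decidable Chosen
    chosen? r = (r ∈? R) ×-dec ¬? (adj? G w r) ×-dec
                all? (λ s → (s ∈? R) →-dec (adj? G r s →-dec (adj? G w s ⊎-dec (r Fin.<? s))))

    B : Subset n
    B = tabulate (does ∘ chosen?)

    B-chosen : ∀ {r} → r ∈ B → Chosen r
    B-chosen = ∈-tabulate⁻ chosen?

    B-stableIn : StableIn G R B
    B-stableIn = proj₁ ∘ B-chosen , B-stable
      where
      B-stable : Stable G B
      B-stable r r′ r∈B r′∈B r~r′
        with _ , w≁r , r-choice ← B-chosen r∈B | r′∈R , w≁r′ , r′-choice ← B-chosen r′∈B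
        with r-choice r′ r′∈R r~r′ | r′-choice r (proj₁ (B-chosen r∈B)) (Adj-sym G r~r′)
      ... | inj₁ w~r′ | _         = w≁r′ w~r′
      ... | inj₂ _    | inj₁ w~r  = w≁r w~r
      ... | inj₂ r<r′ | inj₂ r′<r = Finₚ.<-asym r<r′ r′<r

    partner-chosen : ∀ {x} → x ∈ R → x ∉ B → ∃ λ s → s ∈ B × Adj G x s
    partner-chosen {x} x∈R x∉B with s , x-leaf ← R-regular x∈R =
      s , ∈-tabulate⁺ chosen? s-chosen , x~s
      where
      open Leaf x-leaf using () renaming (v∈W to s∈R; u~v to x~s; only-v to x-only-s)
      s-only-x : ∀ t → t ∈ R → Adj G s t → t ≡ x
      s-only-x t t∈R s~t with _ , s-leaf ← R-regular s∈R =
        trans (Leaf.only-v s-leaf t t∈R s~t) (sym (Leaf.only-v s-leaf x x∈R (Adj-sym G x~s)))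
      s-chosen : Chosen s
      s-chosen with adj? G w x
      ... | yes w~x = s∈R , acyclic⇒triangle-free G acyclic w~x x~s ,
                      λ t t∈R s~t → inj₁ (subst (Adj G w) (sym (s-only-x t t∈R s~t)) w~x)
      ... | no w≁x = s∈R , x-not-chosen ∘ inj₁ ,
                     λ t t∈R s~t → inj₂ (subst (s Fin.<_) (sym (s-only-x t t∈R s~t)) s<x)
        where
        x-not-chosen : ¬ (Adj G w s ⊎ x Fin.< s)
        x-not-chosen w~s⊎x<s = x∉B (∈-tabulate⁺ chosen?
          (x∈R , w≁x , λ t t∈R x~t →
                        subst (λ t → Adj G w t ⊎ x Fin.< t) (sym (x-only-s t t∈R x~t)) w~s⊎x<s))
        s<x : s Fin.< x
        s<x with Finₚ.<-cmp x s
        ... | tri< x<s _ _ = ⊥-elim (x-not-chosen (inj₂ x<s))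
        ... | tri≈ _ x≡s _ = ⊥-elim (Adj-irrefl G x≡s x~s)
        ... | tri> _ _ s<x = s<x

    B-maximal : MaximalStableIn G R B
    B-maximal = B-stableIn , λ {x} x∈R → case x ∈? B of λ where
      (yes x∈B) → inj₁ x∈B
      (no x∉B)  → inj₂ (partner-chosen x∈R x∉B)

    M₁ M₂ : Subset n
    M₁ = ⁅ v ⁆ ∪ B
    M₂ = ⁅ w ⁆ ∪ (⁅ u ⁆ ∪ B)

    M₁-maximal : MaximalStableIn G W M₁
    M₁-maximal = maximalStableIn-insertCentre G v∈W B-maximal

    ∣M₁∣ : ∣ M₁ ∣ ≡ suc ∣ B ∣
    ∣M₁∣ = ∣⁅v⁆∪S∣ G B-stableIn

    u∉R : u ∉ R
    u∉R u∈R = proj₂ (proj₂ (∈─closedNbhd⁻ G u∈R)) (Adj-sym G u~v)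

    w∉R : w ∉ R
    w∉R w∈R = proj₂ (proj₂ (∈─closedNbhd⁻ G w∈R)) v~w

    u≁B : ∀ {b} → b ∈ B → ¬ Adj G u b
    u≁B b∈B u~b = let b∈W , b≢v , _ = ∈─closedNbhd⁻ G (proj₁ B-stableIn b∈B) in
                  b≢v (only-v _ b∈W u~b)

    w≁u+B : ∀ {x} → x ∈ ⁅ u ⁆ ∪ B → ¬ Adj G w x
    w≁u+B x∈ with ∈-⁅x⁆∪p⁻ x∈
    ... | inj₁ refl = λ w~u → Adj-irrefl G refl (subst (Adj G v) (only-v _ w∈W (Adj-sym G w~u)) v~w)
    ... | inj₂ x∈B  = proj₁ (proj₂ (B-chosen x∈B))

    M₂-stableIn : StableIn G W M₂
    M₂-stableIn =
      M₂⊆W , stable-insert G ∈-⁅x⁆∪p⁻ (stable-insert G ∈-⁅x⁆∪p⁻ (proj₂ B-stableIn) u≁B) w≁u+B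
      where
      M₂⊆W : M₂ ⊆ W
      M₂⊆W x∈ with ∈-⁅x⁆∪p⁻ x∈
      ... | inj₁ refl = w∈W
      ... | inj₂ x∈u+B with ∈-⁅x⁆∪p⁻ x∈u+B
      ...   | inj₁ refl = u∈W
      ...   | inj₂ x∈B  = proj₁ (∈─closedNbhd⁻ G (proj₁ B-stableIn x∈B))

    ∣M₂∣ : w ≢ u → ∣ M₂ ∣ ≡ suc (suc ∣ B ∣)
    ∣M₂∣ w≢u = trans (∣⁅x⁆∪p∣ w∉u+B) (cong suc (∣⁅x⁆∪p∣ (u∉R ∘ proj₁ B-stableIn)))
      where
      w∉u+B : w ∉ ⁅ u ⁆ ∪ B
      w∉u+B w∈ = Sum.[ w≢u , w∉R ∘ proj₁ B-stableIn ] (∈-⁅x⁆∪p⁻ w∈)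

  module _ {n} (G : Graph n) (acyclic : Acyclic G) where

    support-isLeaf : ∀ {W u v} → WellCoveredIn G W → OneRegular G (W ─ closedNbhd G v) →
                     Leaf G W u v → Leaf G W v u
    support-isLeaf {W} {u} {v} wellCovered R-regular u-leaf =
      record { u∈W = v∈W ; v∈W = u∈W ; u~v = Adj-sym G u~v ; only-v = only-u }
      where
      open Leaf u-leaf
      only-u : OnlyNeighbour G W v u
      only-u w w∈W v~w with w ≟ u
      ... | yes w≡u = w≡u
      ... | no  w≢u = ⊥-elim (ℕₚ.<-irrefl refl
              (subst₂ ℕ._≤_ (∣M₂∣ w≢u) ∣M₁∣ (wellCovered M₂-stableIn M₁-maximal)))
        where open SupportVertex G acyclic u-leaf R-regular w∈W v~w

  module _ {m} (G : Graph (suc m)) (acyclic : Acyclic G) where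

    wellCoveredIn⇒oneRegular : ∀ W → WellCoveredIn G W → alternatingCount G W ≢ 0ℤ → OneRegular G W
    wellCoveredIn⇒oneRegular W = go W (⊂-wellFounded W)
      where
      go : ∀ W → Acc _⊂_ W → WellCoveredIn G W → alternatingCount G W ≢ 0ℤ → OneRegular G W
      go W (acc smaller) wellCovered c≢0 with forestView G acyclic W
      ... | empty W-empty       = λ x∈W → ⊥-elim (W-empty (_ , x∈W))
      ... | isolated x-isolated = ⊥-elim (c≢0 (alternatingCount-isolated G x-isolated))
      ... | leaf {u} {v} u-leaf = W-regular
        where
        open Leaf u-leaf
        R-regular : OneRegular G (W ─ closedNbhd G v)
        R-regular = go _ (smaller (─closedNbhd⊂ G v∈W)) (wellCoveredIn-─closedNbhd G v∈W wellCovered)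
                      (λ cR≡0 → c≢0 (trans (alternatingCount-leaf G u-leaf) (cong -_ cR≡0)))
        v-leaf : Leaf G W v u
        v-leaf = support-isLeaf G acyclic wellCovered R-regular u-leaf
        v≁ : ∀ {x} → x ∈ W → x ≢ u → ¬ Adj G v x
        v≁ x∈W x≢u v~x = x≢u (Leaf.only-v v-leaf _ x∈W v~x)
        W-regular : OneRegular G W
        W-regular {x} x∈W with x ≟ v | x ≟ u
        ... | yes refl | _        = u , v-leaf
        ... | no _     | yes refl = v , u-leaf
        ... | no x≢v   | no x≢u
          with y , x-leaf ← R-regular (∈─closedNbhd⁺ G x∈W x≢v (v≁ x∈W x≢u)) =
          y , leaf-lift G (p─q⊆p W (closedNbhd G v)) x-leaf λ z z∈W x~z →
                ∈─closedNbhd⁺ G z∈W (λ { refl → v≁ x∈W x≢u (Adj-sym G x~z) })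
                            (λ v~z → x≢v (only-v x x∈W
                                            (Adj-sym G (subst (Adj G x) (Leaf.only-v v-leaf z z∈W v~z) x~z))))

  module ConnectedOneRegular {m} (G : Graph (suc m)) (connected : Connected G) (regular : OneRegular G ⊤) where

    partner : Fin (suc m)
    partner = proj₁ (regular (∈⊤ {x = zero}))

    zero-leaf : Leaf G ⊤ zero partner
    zero-leaf = proj₂ (regular ∈⊤)

    partner≢zero : partner ≢ zero
    partner≢zero partner≡zero = Adj-irrefl G (sym partner≡zero) (Leaf.u~v zero-leaf)

    zero-or-partner : ∀ z → z ≡ zero ⊎ z ≡ partner
    zero-or-partner z = reach (connected zero z) (inj₁ refl)
      where
      reach : ∀ {x z} → Walk G x z → x ≡ zero ⊎ x ≡ partner → z ≡ zero ⊎ z ≡ partner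
      reach here                 x≡0⊎x≡b    = x≡0⊎x≡b
      reach (step x~y walk) (inj₁ refl) = reach walk (inj₂ (Leaf.only-v zero-leaf _ ∈⊤ x~y))
      reach (step x~y walk) (inj₂ refl) with _ , partner-leaf ← regular (∈⊤ {x = partner}) =
        reach walk (inj₁ (trans (Leaf.only-v partner-leaf _ ∈⊤ x~y)
                                (sym (Leaf.only-v partner-leaf zero ∈⊤ (Adj-sym G (Leaf.u~v zero-leaf))))))

  connected∧oneRegular⇒≅K₂ : ∀ {m} (G : Graph (suc m)) → Connected G → OneRegular G ⊤ → G ≅ K₂
  connected∧oneRegular⇒≅K₂ {zero} G connected regular with partner | partner≢zero
    where open ConnectedOneRegular G connected regular
  ... | zero | partner≢zero = ⊥-elim (partner≢zero refl)
  connected∧oneRegular⇒≅K₂ {suc (suc _)} G connected regular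
    with zero-or-partner (suc zero) | zero-or-partner (suc (suc zero))
    where open ConnectedOneRegular G connected regular
  ... | inj₂ 1≡partner | inj₂ 2≡partner with () ← trans 1≡partner (sym 2≡partner)
  connected∧oneRegular⇒≅K₂ {suc zero} G connected regular =
    ↔-id _ , λ x y → mk⇔ (λ x~y x≡y → Adj-irrefl G x≡y x~y) (distinct⇒adjacent x y)
    where
    open ConnectedOneRegular G connected regular
    zero~one : Adj G zero (suc zero)
    zero~one with partner | partner≢zero | Leaf.u~v zero-leaf
    ... | suc zero | _ | zero~partner = zero~partner
    ... | zero | partner≢zero | _ = ⊥-elim (partner≢zero refl)
    distinct⇒adjacent : ∀ x y → x ≢ y → Adj G x y
    distinct⇒adjacent zero       zero       x≢y = ⊥-elim (x≢y refl)
    distinct⇒adjacent zero       (suc zero) _   = zero~one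
    distinct⇒adjacent (suc zero) zero       _   = Adj-sym G zero~one
    distinct⇒adjacent (suc zero) (suc zero) x≢y = ⊥-elim (x≢y refl)

  -- Counting stable and dependent sets by parity

  module _ {m} (G : Graph (suc m)) where

    stableEven? stableOdd? dependentEven? dependentOdd? : (S : Subset (suc m)) → Dec _
    stableEven?    S = stable? G S ×-dec even? ∣ S ∣
    stableOdd?     S = stable? G S ×-dec ¬? (even? ∣ S ∣)
    dependentEven? S = dependent? G S ×-dec even? ∣ S ∣
    dependentOdd?  S = dependent? G S ×-dec ¬? (even? ∣ S ∣)

    #stable≡#stableEven+#stableOdd : #stable G ≡ count stableEven? ℕ.+ count stableOdd?
    #stable≡#stableEven+#stableOdd =
      length-filter-split (stable? G) (even? ∘ ∣_∣) (allSubsets (suc m))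

    #dependent≡#dependentEven+#dependentOdd : #dependent G ≡ #dependentEven G ℕ.+ #dependentOdd G
    #dependent≡#dependentEven+#dependentOdd =
      length-filter-split (dependent? G) (even? ∘ ∣_∣) (allSubsets (suc m))

    alternatingCount-⊤ : alternatingCount G ⊤ ≡ + count stableEven? - + count stableOdd?
    alternatingCount-⊤ = begin
      alternatingCount G ⊤
        ≡⟨ sumSubsets-cong (λ S → ifSign-as-indicators (S ⊆? ⊤) ⊆⊤ (stable? G S) (even? ∣ S ∣)) ⟩
      sumSubsets (λ S → indicator (stableEven? S) - indicator (stableOdd? S))
        ≡⟨ sumSubsets-- (indicator ∘ stableEven?) (indicator ∘ stableOdd?) ⟩
      sumSubsets (indicator ∘ stableEven?) - sumSubsets (indicator ∘ stableOdd?)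
        ≡⟨ sym (cong₂ _-_ (count-as-sum stableEven?) (count-as-sum stableOdd?)) ⟩
      + count stableEven? - + count stableOdd? ∎
      where open ≡-Reasoning

    #dependentEven-#dependentOdd : + #dependentEven G - + #dependentOdd G ≡ - alternatingCount G ⊤
    #dependentEven-#dependentOdd = begin
      + #dependentEven G - + #dependentOdd G
        ≡⟨ cong₂ _-_ (count-as-sum dependentEven?) (count-as-sum dependentOdd?) ⟩
      sumSubsets (indicator ∘ dependentEven?) - sumSubsets (indicator ∘ dependentOdd?)
        ≡⟨ sym (sumSubsets-- (indicator ∘ dependentEven?) (indicator ∘ dependentOdd?)) ⟩
      sumSubsets (λ S → indicator (dependentEven? S) - indicator (dependentOdd? S))
        ≡⟨ sumSubsets-cong (λ S → complement-as-indicators (S ⊆? ⊤) ⊆⊤ (stable? G S) (even? ∣ S ∣)) ⟩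
      sumSubsets (λ S → sign ∣ S ∣ - stableSign G ⊤ S)
        ≡⟨ sumSubsets-- {suc m} (sign ∘ ∣_∣) (stableSign G ⊤) ⟩
      sumSubsets {suc m} (sign ∘ ∣_∣) - alternatingCount G ⊤
        ≡⟨ cong (_- alternatingCount G ⊤) (sumSubsets-sign {m}) ⟩
      0ℤ - alternatingCount G ⊤
        ≡⟨ ℤₚ.+-identityˡ _ ⟩
      - alternatingCount G ⊤ ∎
      where open ≡-Reasoning

    wellCoveredTree⇒alternatingCount≡0 : Tree G → WellCovered G → ¬ (G ≅ K₂) →
                                         alternatingCount G ⊤ ≡ 0ℤ
    wellCoveredTree⇒alternatingCount≡0 (_ , connected , acyclic) wellCovered ≇K₂
      with alternatingCount G ⊤ ℤ.≟ 0ℤ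
    ... | yes c≡0 = c≡0
    ... | no  c≢0 = ⊥-elim (≇K₂ (connected∧oneRegular⇒≅K₂ G connected
            (wellCoveredIn⇒oneRegular G acyclic ⊤ (wellCovered⇒wellCoveredIn⊤ G wellCovered) c≢0)))

  m≡n⇒even[m+n] : ∀ {m n} → m ≡ n → Even (m ℕ.+ n)
  m≡n⇒even[m+n] {m} refl = divides m (trans (cong (m ℕ.+_) (sym (ℕₚ.+-identityʳ m))) (ℕₚ.*-comm 2 m))

  tree⇒∣#dependentEven⊖#dependentOdd∣≤1 : ∀ {n} (T : Graph n) → Tree T →
                                           ℤ.∣ #dependentEven T ⊖ #dependentOdd T ∣ ℕ.≤ 1
  tree⇒∣#dependentEven⊖#dependentOdd∣≤1 {suc _} T (_ , _ , acyclic) = begin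
    ℤ.∣ #dependentEven T ⊖ #dependentOdd T ∣      ≡⟨ cong ℤ.∣_∣ (ℤₚ.m-n≡m⊖n (#dependentEven T) (#dependentOdd T)) ⟨
    ℤ.∣ + #dependentEven T - + #dependentOdd T ∣  ≡⟨ cong ℤ.∣_∣ (#dependentEven-#dependentOdd T) ⟩
    ℤ.∣ - alternatingCount T ⊤ ∣                  ≡⟨ ℤₚ.∣-i∣≡∣i∣ (alternatingCount T ⊤) ⟩
    ℤ.∣ alternatingCount T ⊤ ∣                    ≤⟨ ∣alternatingCount∣≤1 T acyclic ⊤ ⟩
    1                                             ∎
    where open ℕₚ.≤-Reasoning

  wellCoveredTree⇒#dependentEven≡#dependentOdd : ∀ {n} (T : Graph n) → Tree T → WellCovered T →
                                                ¬ (T ≅ K₂) → #dependentEven T ≡ #dependentOdd T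
  wellCoveredTree⇒#dependentEven≡#dependentOdd {suc _} T tree wellCovered ≇K₂ =
    ℤₚ.+-injective (ℤₚ.i-j≡0⇒i≡j _ _
      (trans (#dependentEven-#dependentOdd T) (cong -_ (wellCoveredTree⇒alternatingCount≡0 T tree wellCovered ≇K₂))))

  wellCoveredTree⇒even-counts : ∀ {n} (T : Graph n) → Tree T → WellCovered T → ¬ (T ≅ K₂) →
                                Even (#stable T) × Even (#dependent T)
  wellCoveredTree⇒even-counts {suc _} T tree wellCovered ≇K₂ =
    subst Even (sym (#stable≡#stableEven+#stableOdd T)) (m≡n⇒even[m+n] #stableEven≡#stableOdd) ,
    subst Even (sym (#dependent≡#dependentEven+#dependentOdd T))
          (m≡n⇒even[m+n] (wellCoveredTree⇒#dependentEven≡#dependentOdd T tree wellCovered ≇K₂))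
    where
    #stableEven≡#stableOdd : count (stableEven? T) ≡ count (stableOdd? T)
    #stableEven≡#stableOdd = ℤₚ.+-injective (ℤₚ.i-j≡0⇒i≡j _ _
      (trans (sym (alternatingCount-⊤ T)) (wellCoveredTree⇒alternatingCount≡0 T tree wellCovered ≇K₂)))

open import Defs
open import Data.Nat using (ℕ; zero; suc; _≤_; ∣_-_∣)
open import Data.Integer as ℤ using (_⊖_)
open import Data.Integer.Properties using ([1+m]⊖[1+n]≡m⊖n)
open import Data.Product using (_×_; _,_)
open import Relation.Nullary using (¬_)
open import Relation.Binary.PropositionalEquality using (_≡_; refl; trans; cong; subst)
open AlternatingCount
  using ( tree⇒∣#dependentEven⊖#dependentOdd∣≤1 ; wellCoveredTree⇒#dependentEven≡#dependentOdd
        ; wellCoveredTree⇒even-counts )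

∣m⊖n∣≡∣m-n∣ : ∀ m n → ℤ.∣ m ⊖ n ∣ ≡ ∣ m - n ∣
∣m⊖n∣≡∣m-n∣ zero    zero    = refl
∣m⊖n∣≡∣m-n∣ zero    (suc n) = refl
∣m⊖n∣≡∣m-n∣ (suc m) zero    = refl
∣m⊖n∣≡∣m-n∣ (suc m) (suc n) = trans (cong ℤ.∣_∣ ([1+m]⊖[1+n]≡m⊖n m n)) (∣m⊖n∣≡∣m-n∣ m n)

tree⇒∣#dependentEven-#dependentOdd∣≤1 : ∀ {n} (T : Graph n) → Tree T →
                                         ∣ #dependentEven T - #dependentOdd T ∣ ≤ 1
tree⇒∣#dependentEven-#dependentOdd∣≤1 T tree =
  subst (_≤ 1) (∣m⊖n∣≡∣m-n∣ (#dependentEven T) (#dependentOdd T)) (tree⇒∣#dependentEven⊖#dependentOdd∣≤1 T tree)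

corollary2p5 : (∀ {n} (T : Graph n) → Tree T →
    ∣ #dependentEven T - #dependentOdd T ∣ ≤ 1)
    × (∀ {n} (T : Graph n) → Tree T → WellCovered T → ¬ (T ≅ K₂) →
    #dependentEven T ≡ #dependentOdd T)
    × (∀ {n} (T : Graph n) → Tree T → WellCovered T → ¬ (T ≅ K₂) →
    Even (#stable T) × Even (#dependent T))
corollary2p5 = tree⇒∣#dependentEven-#dependentOdd∣≤1
             , wellCoveredTree⇒#dependentEven≡#dependentOdd
             , wellCoveredTree⇒even-counts
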